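{- Let $X$ be a finite metric space, $a_0\in X$, $P\subseteq\mathcal{P}_X$ with $P=P^{ -1}$ and $X\setminus\{a_0\}\subseteq P(a_0)$. Then the weight function $w$ on $\Gamma$ is reduced, i.e. $d_w(x,y)=w(x,y)$ for every edge $(x,y)$ of $\Gamma$.
   Context: A partial isometry of $X$ is an isometry between finite subsets of $X$; $\mathcal{P}_X$ is the set of those not contained in the identity; $P(a_0)=\{p(a_0):p\in P,\ a_0\in\mathrm{dom}(p)\}$. $\mathbb{F}(P)$ is the free group on $P$ with $p^{ -1}\in P$ identified with the formal inverse of $p$. $H\le\mathbb{F}(P)$ is the subgroup of elements represented by words $p_1\cdots p_n$ ($p_i\in P$) such that $p_1(p_2(\cdots p_n(a_0)\cdots))$ is defined and equals $a_0$. $\Gamma=\{gH:g\in\mathbb{F}(P)\}$ is made into a weighted graph $(\Gamma,w)$ with an edge between $gpH$ and $gqH$ (when distinct) for every $g\in\mathbb{F}(P)$ and $p,q\in P\cup\{1\}$ with $p(a_0),q(a_0)$ defined, of weight $w(gpH,gqH)=d_X(p(a_0),q(a_0))$ (this is well defined). With $B_w=\sup$ of all edge weights, the path metric is $d_w(x,y)=\min\{B_w,\delta_w(x,y)\}$, where $\delta_w(x,y)$ is the infimum of $\sum_{i=1}^n w(x_i,x_{i+1})$ over edge paths $x=x_1,\dots,x_{n+1}=y$ (and $\delta_w(x,y)=\infty$ if there is no such path). -}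

module Defs where

open import Data.Nat using (ℕ)
open import Data.Fin using (Fin)
open import Data.Maybe using (Maybe; just; nothing; _>>=_)
open import Data.Vec using (Vec; lookup)
open import Data.List using (List; []; _∷_; _++_; [_])
open import Data.List.Relation.Unary.All using (All)
open import Data.Product using (Σ; _×_; _,_; ∃; ∃-syntax)
open import Data.Sum using (_⊎_)
open import Data.Unit using (⊤)
open import Relation.Nullary using (¬_)
open import Relation.Binary.PropositionalEquality using (_≡_; _≢_)

record OrderedAbelianGroup : Set₁ where
  infixl 6 _+_
  infix 4 _≤_
  field
    Carrier   : Set
    0#        : Carrier
    _+_       : Carrier → Carrier → Carrier
    -_        : Carrier → Carrier
    _≤_       : Carrier → Carrier → Set
    +-assoc   : ∀ x y z → (x + y) + z ≡ x + (y + z)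
    +-comm    : ∀ x y → x + y ≡ y + x
    +-identityˡ : ∀ x → 0# + x ≡ x
    -‿inverseˡ : ∀ x → (- x) + x ≡ 0#
    ≤-refl    : ∀ x → x ≤ x
    ≤-trans   : ∀ {x y z} → x ≤ y → y ≤ z → x ≤ z
    ≤-antisym : ∀ {x y} → x ≤ y → y ≤ x → x ≡ y
    ≤-total   : ∀ x y → x ≤ y ⊎ y ≤ x
    +-monoˡ-≤ : ∀ {x y} z → x ≤ y → x + z ≤ y + z

module _ (V : OrderedAbelianGroup) where
  open OrderedAbelianGroup V

  record IsMetric {n : ℕ} (d : Fin n → Fin n → Carrier) : Set where
    field
      d-refl  : ∀ a → d a a ≡ 0#
      d-zero  : ∀ a b → d a b ≡ 0# → a ≡ b
      d-sym   : ∀ a b → d a b ≡ d b a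
      d-tri   : ∀ a b c → d a c ≤ d a b + d b c

  IsSup : (Carrier → Set) → Carrier → Set
  IsSup S v = (∀ s → S s → s ≤ v) × (∀ u → (∀ s → S s → s ≤ u) → v ≤ u)

  IsInf : (Carrier → Set) → Carrier → Set
  IsInf S v = (∀ s → S s → v ≤ s) × (∀ u → (∀ s → S s → u ≤ s) → u ≤ v)

  IsMin : Carrier → Carrier → Carrier → Set
  IsMin a b m = (m ≡ a ⊎ m ≡ b) × m ≤ a × m ≤ b

-- Partial maps of X = Fin n, represented by their graph as a table
-- (so that ≡ is extensional equality of partial maps).

PMap : ℕ → Set
PMap n = Vec (Maybe (Fin n)) n

app : ∀ {n} → PMap n → Fin n → Maybe (Fin n)
app p a = lookup p a

module _ (V : OrderedAbelianGroup) where
  open OrderedAbelianGroup V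

  IsPartialIsometry : ∀ {n} → (Fin n → Fin n → Carrier) → PMap n → Set
  IsPartialIsometry d p =
    ∀ a b a' b' → app p a ≡ just a' → app p b ≡ just b' → d a' b' ≡ d a b

NotInIdentity : ∀ {n} → PMap n → Set
NotInIdentity p = ∃[ a ] ∃[ b ] (app p a ≡ just b × b ≢ a)

IsInverse : ∀ {n} → PMap n → PMap n → Set
IsInverse p q = ∀ a b → (app p a ≡ just b → app q b ≡ just a)
                      × (app q b ≡ just a → app p a ≡ just b)

module Graph {n : ℕ} (a₀ : Fin n) (P : PMap n → Set) where

  Word : Set
  Word = List (PMap n)

  -- equality in 𝔽(P): congruence generated by cancelling p p⁻¹
  -- (p, p⁻¹ ∈ P, with p⁻¹ identified with the formal inverse of p)
  data _≈F_ : Word → Word → Set where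
    cancel : ∀ u v p q → P p → P q → IsInverse p q →
             (u ++ p ∷ q ∷ v) ≈F (u ++ v)
    ≈-refl  : ∀ {u} → u ≈F u
    ≈-sym   : ∀ {u v} → u ≈F v → v ≈F u
    ≈-trans : ∀ {u v w} → u ≈F v → v ≈F w → u ≈F w

  eval : Word → Fin n → Maybe (Fin n)
  eval []       a = just a
  eval (p ∷ w) a = eval w a >>= app p

  InH : Word → Set
  InH h = All P h × ∃[ w ] (All P w × w ≈F h × eval w a₀ ≡ just a₀)

  SameCoset : Word → Word → Set
  SameCoset g g' = ∃[ h ] (InH h × g' ≈F (g ++ h))

  -- elements of P ∪ {1}  (nothing = 1)
  InP1 : Maybe (PMap n) → Set
  InP1 nothing  = ⊤
  InP1 (just p) = P p

  ext : Word → Maybe (PMap n) → Word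
  ext g nothing  = g
  ext g (just p) = g ++ [ p ]

  at₀ : Maybe (PMap n) → Maybe (Fin n)
  at₀ nothing  = just a₀
  at₀ (just p) = app p a₀

  module Weighted (V : OrderedAbelianGroup)
                  (d : Fin n → Fin n → OrderedAbelianGroup.Carrier V) where
    open OrderedAbelianGroup V

    -- Edge x y r : there is an edge between the vertices xH and yH of Γ
    -- (coming from g, p, q) and its weight w(xH, yH) is r.
    Edge : Word → Word → Carrier → Set
    Edge x y r =
      All P x × All P y × ¬ SameCoset x y ×
      ∃[ g ] ∃[ p ] ∃[ q ] ∃[ a ] ∃[ b ]
        ( All P g × InP1 p × InP1 q
        × at₀ p ≡ just a × at₀ q ≡ just b
        × SameCoset (ext g p) x × SameCoset (ext g q) y
        × r ≡ d a b )

    EdgeWeight : Carrier → Set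
    EdgeWeight r = ∃[ x ] ∃[ y ] Edge x y r

    data Path : Word → Word → Carrier → Set where
      nil  : ∀ {x y} → SameCoset x y → Path x y 0#
      cons : ∀ {x z y r s} → Edge x z r → Path z y s → Path x y (r + s)

-- For a word s₁ ⋯ sₖ over P and points a, b, a chain picks fᵢ ∈ dom sᵢ and costs
-- d(a, s₁ f₁) + d(f₁, s₂ f₂) + ⋯ + d(fₖ, b). As the letters are partial isometries, cancelling a
-- pair s s⁻¹ never raises the cheapest cost, so the cost of the reduced word depends only on the
-- element of 𝔽(P); it is subadditive, and it vanishes from a₀ to a₀ on H. An edge path of weight s
-- from xH to yH therefore bounds the cost of x⁻¹y by s. For an edge of weight d(a, b) we have
-- x = gU, y = gW with U a₀ = a and W a₀ = b, so x⁻¹y = U⁻¹W, and multiplying by U on the left and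
-- by W⁻¹ on the right turns a chain of U⁻¹W from a₀ to a₀ into one of the empty word from a to b,
-- whose cost is d(a, b).

module Submission where

open import Defs
open import Data.Nat using (ℕ)
open import Data.Fin using (Fin)
open import Data.Fin.Properties using (all?) renaming (_≟_ to _≟ᶠ_)
open import Data.Maybe using (Maybe; just; nothing; _>>=_)
open import Data.Maybe.Properties using (≡-dec)
open import Data.Vec using (lookup; tabulate)
open import Data.Vec.Properties using (tabulate∘lookup; tabulate-cong)
open import Data.List using (List; []; _∷_; _++_; [_]; foldr)
open import Data.List.Properties using (foldr-++; ++-assoc; ++-identityʳ)
open import Data.List.Relation.Unary.All as All using (All; []; _∷_)
open import Data.List.Relation.Unary.All.Properties using (++⁺)
open import Data.Product using (_×_; _,_; proj₁; proj₂; ∃-syntax)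
open import Data.Sum using (inj₁; inj₂)
open import Data.Unit using (⊤; tt)
open import Data.Empty using (⊥-elim)
open import Relation.Nullary using (¬_; yes; no)
open import Relation.Nullary.Decidable using (_×-dec_; _→-dec_)
open import Relation.Binary.Bundles using (Setoid; Poset)
open import Relation.Binary.Definitions using (Decidable)
open import Relation.Binary.PropositionalEquality hiding ([_])
import Relation.Binary.Reasoning.Setoid as SetoidReasoning
import Relation.Binary.Reasoning.PartialOrder as PosetReasoning

module OrderedAbelianGroupProperties (V : OrderedAbelianGroup) where
  open OrderedAbelianGroup V

  ≡⇒≤ : ∀ {x y} → x ≡ y → x ≤ y
  ≡⇒≤ {x} refl = ≤-refl x

  ≤-poset : Poset _ _ _
  ≤-poset = record
    { _≈_ = _≡_
    ; _≤_ = _≤_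
    ; isPartialOrder = record
      { isPreorder = record { isEquivalence = isEquivalence ; reflexive = ≡⇒≤ ; trans = ≤-trans }
      ; antisym = ≤-antisym
      }
    }

  module ≤-Reasoning = PosetReasoning ≤-poset

  +-identityʳ : ∀ x → x + 0# ≡ x
  +-identityʳ x = trans (+-comm x 0#) (+-identityˡ x)

  +-monoʳ-≤ : ∀ {x y} z → x ≤ y → z + x ≤ z + y
  +-monoʳ-≤ {x} {y} z x≤y = subst₂ _≤_ (+-comm x z) (+-comm y z) (+-monoˡ-≤ z x≤y)

  +-mono-≤ : ∀ {x x′ y y′} → x ≤ x′ → y ≤ y′ → x + y ≤ x′ + y′
  +-mono-≤ {x′ = x′} {y} x≤x′ y≤y′ = ≤-trans (+-monoˡ-≤ y x≤x′) (+-monoʳ-≤ x′ y≤y′)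

  IsMin-≤ : ∀ {b r m} → r ≤ b → IsMin V b r m → m ≡ r
  IsMin-≤ r≤b (inj₁ refl , _ , m≤r) = ≤-antisym m≤r r≤b
  IsMin-≤ r≤b (inj₂ m≡r , _ , _)    = m≡r

module FreeReduction {A : Set} (Inverse : A → A → Set) (inverse? : Decidable Inverse)
  (inverse-unique : ∀ {s t u} → Inverse s t → Inverse t u → s ≡ u) where

  push : A → List A → List A
  push s [] = [ s ]
  push s (t ∷ u) with inverse? s t
  ... | yes _ = u
  ... | no _  = s ∷ t ∷ u

  nf : List A → List A
  nf = foldr push []

  Reduced : List A → Set
  Reduced (s ∷ t ∷ u) = ¬ Inverse s t × Reduced (t ∷ u)
  Reduced _           = ⊤

  Reduced-tail : ∀ {s u} → Reduced (s ∷ u) → Reduced u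
  Reduced-tail {u = []}    _       = tt
  Reduced-tail {u = _ ∷ _} (_ , r) = r

  push-Reduced : ∀ s {u} → Reduced u → Reduced (push s u)
  push-Reduced s {[]}    r = tt
  push-Reduced s {t ∷ u} r with inverse? s t
  ... | yes _  = Reduced-tail r
  ... | no ¬st = ¬st , r

  foldr-push-Reduced : ∀ {v} u → Reduced v → Reduced (foldr push v u)
  foldr-push-Reduced []      r = r
  foldr-push-Reduced (s ∷ u) r = push-Reduced s (foldr-push-Reduced u r)

  nf-Reduced : ∀ u → Reduced (nf u)
  nf-Reduced u = foldr-push-Reduced u tt

  Reduced⇒nf-fixed : ∀ {u} → Reduced u → nf u ≡ u
  Reduced⇒nf-fixed {[]}        _ = refl
  Reduced⇒nf-fixed {_ ∷ []}    _ = refl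
  Reduced⇒nf-fixed {s ∷ t ∷ u} (¬st , r) rewrite Reduced⇒nf-fixed r with inverse? s t
  ... | yes st = ⊥-elim (¬st st)
  ... | no _   = refl

  push-cancel : ∀ {s t} → Inverse s t → ∀ u → Reduced u → push s (push t u) ≡ u
  push-cancel {s} {t} st [] _ with inverse? s t
  ... | yes _  = refl
  ... | no ¬st = ⊥-elim (¬st st)
  push-cancel {s} {t} st (k ∷ u) r with inverse? t k
  push-cancel {s} {t} st (k ∷ u) r | no _ with inverse? s t
  ... | yes _  = refl
  ... | no ¬st = ⊥-elim (¬st st)
  push-cancel {s} {t} st (k ∷ u) r | yes tk with inverse-unique st tk
  push-cancel st (_ ∷ [])     r         | yes _ | refl = refl
  push-cancel {s} st (_ ∷ k′ ∷ u) (¬sk′ , _) | yes _ | refl with inverse? s k′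
  ... | yes sk′ = ⊥-elim (¬sk′ sk′)
  ... | no _    = refl

  foldr-push-push : ∀ s {v} u → Reduced v → foldr push v (push s u) ≡ push s (foldr push v u)
  foldr-push-push s []          _ = refl
  foldr-push-push s {v} (t ∷ u) r with inverse? s t
  ... | yes st = sym (push-cancel st (foldr push v u) (foldr-push-Reduced u r))
  ... | no _   = refl

  foldr-push-nf : ∀ {v} u → Reduced v → foldr push v (nf u) ≡ foldr push v u
  foldr-push-nf []      _ = refl
  foldr-push-nf (s ∷ u) r = trans (foldr-push-push s (nf u) r) (cong (push s) (foldr-push-nf u r))

  nf-++ : ∀ u v → nf (u ++ v) ≡ foldr push (nf v) u
  nf-++ u v = foldr-++ push [] u v

  push-All : ∀ {Q : A → Set} {s u} → Q s → All Q u → All Q (push s u)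
  push-All {u = []}    qs _ = qs ∷ []
  push-All {s = s} {t ∷ u} qs qu with inverse? s t
  push-All qs (_ ∷ qu) | yes _ = qu
  push-All qs qu       | no _  = qs ∷ qu

  nf-All : ∀ {Q : A → Set} {u} → All Q u → All Q (nf u)
  nf-All []        = []
  nf-All (qs ∷ qu) = push-All qs (nf-All qu)

  infix 4 _~_
  record _~_ (u v : List A) : Set where
    constructor mk~
    field nf≡ : nf u ≡ nf v
  open _~_ public

  ~-setoid : Setoid _ _
  ~-setoid = record
    { Carrier = List A
    ; _≈_ = _~_
    ; isEquivalence = record
      { refl  = mk~ refl
      ; sym   = λ u~v → mk~ (sym (nf≡ u~v))
      ; trans = λ u~v v~w → mk~ (trans (nf≡ u~v) (nf≡ v~w))
      }
    }

  module ~-Reasoning = SetoidReasoning ~-setoid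
  open Setoid ~-setoid public using () renaming (refl to ~-refl; sym to ~-sym; trans to ~-trans)

  ≡⇒~ : ∀ {u v} → u ≡ v → u ~ v
  ≡⇒~ refl = ~-refl

  nf-~ : ∀ u → nf u ~ u
  nf-~ u = mk~ (Reduced⇒nf-fixed (nf-Reduced u))

  ~-congʳ : ∀ u {v v′} → v ~ v′ → u ++ v ~ u ++ v′
  ~-congʳ u {v} {v′} (mk~ v~v′) = mk~ (begin
    nf (u ++ v)            ≡⟨ nf-++ u v ⟩
    foldr push (nf v) u    ≡⟨ cong (λ w → foldr push w u) v~v′ ⟩
    foldr push (nf v′) u   ≡⟨ nf-++ u v′ ⟨
    nf (u ++ v′)           ∎)
    where open ≡-Reasoning

  ~-congˡ : ∀ {u u′} v → u ~ u′ → u ++ v ~ u′ ++ v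
  ~-congˡ {u} {u′} v (mk~ u~u′) = mk~ (begin
    nf (u ++ v)                 ≡⟨ nf-++ u v ⟩
    foldr push (nf v) u         ≡⟨ foldr-push-nf u (nf-Reduced v) ⟨
    foldr push (nf v) (nf u)    ≡⟨ cong (foldr push (nf v)) u~u′ ⟩
    foldr push (nf v) (nf u′)   ≡⟨ foldr-push-nf u′ (nf-Reduced v) ⟩
    foldr push (nf v) u′        ≡⟨ nf-++ u′ v ⟨
    nf (u′ ++ v)                ∎)
    where open ≡-Reasoning

  ~-cancel : ∀ u {s t} v → Inverse s t → u ++ s ∷ t ∷ v ~ u ++ v
  ~-cancel u v st = ~-congʳ u (mk~ (push-cancel st (nf v) (nf-Reduced v)))

  ~-erase : ∀ u {w} v → w ~ [] → u ++ w ++ v ~ u ++ v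
  ~-erase u v w~[] = ~-congʳ u (~-congˡ v w~[])

module _ {n : ℕ} where

  PMap-ext : ∀ {p q : PMap n} → (∀ a → app p a ≡ app q a) → p ≡ q
  PMap-ext {p} {q} p≗q = begin
    p                   ≡⟨ tabulate∘lookup p ⟨
    tabulate (lookup p) ≡⟨ tabulate-cong p≗q ⟩
    tabulate (lookup q) ≡⟨ tabulate∘lookup q ⟩
    q                   ∎
    where open ≡-Reasoning

  Maybe-ext : ∀ {B : Set} {m m′ : Maybe B} →
              (∀ {b} → m ≡ just b → m′ ≡ just b) → (∀ {b} → m′ ≡ just b → m ≡ just b) → m ≡ m′
  Maybe-ext {m = just b}               to _    = sym (to refl)
  Maybe-ext {m = nothing} {nothing}    _  _    = refl
  Maybe-ext {m = nothing} {just b}     _  from = from refl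

  IsInverse-sym : ∀ {p q : PMap n} → IsInverse p q → IsInverse q p
  IsInverse-sym pq a b = proj₂ (pq b a) , proj₁ (pq b a)

  IsInverse-unique : ∀ {p q r : PMap n} → IsInverse p q → IsInverse q r → p ≡ r
  IsInverse-unique pq qr = PMap-ext λ a →
    Maybe-ext (λ {b} e → proj₁ (qr b a) (proj₁ (pq a b) e))
              (λ {b} e → proj₂ (pq a b) (proj₂ (qr b a) e))

  IsInverse? : Decidable (IsInverse {n})
  IsInverse? p q = all? λ a → all? λ b →
      (app p a ≟ just b →-dec app q b ≟ just a) ×-dec (app q b ≟ just a →-dec app p a ≟ just b)
    where _≟_ = ≡-dec _≟ᶠ_

module Chains (V : OrderedAbelianGroup) {n : ℕ}
  (d : Fin n → Fin n → OrderedAbelianGroup.Carrier V) (metric : IsMetric V d) where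
  open OrderedAbelianGroup V
  open OrderedAbelianGroupProperties V
  open IsMetric metric
  open FreeReduction (IsInverse {n}) IsInverse? (λ {p} {q} {r} → IsInverse-unique {p = p} {q} {r})
  open ≤-Reasoning

  Isometry : PMap n → Set
  Isometry = IsPartialIsometry V d

  data Chain : List (PMap n) → Fin n → Fin n → Carrier → Set where
    done : ∀ {a b} → Chain [] a b (d a b)
    hop  : ∀ {s w a f sf b t} → app s f ≡ just sf → Chain w f b t → Chain (s ∷ w) a b (d a sf + t)

  Chain≤ : List (PMap n) → Fin n → Fin n → Carrier → Set
  Chain≤ w a b t = ∃[ t′ ] (Chain w a b t′ × t′ ≤ t)

  Chain≤-weaken : ∀ {w a b t u} → Chain≤ w a b t → t ≤ u → Chain≤ w a b u
  Chain≤-weaken (t′ , c , t′≤t) t≤u = t′ , c , ≤-trans t′≤t t≤u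

  Chain-start : ∀ {w c b t} a → Chain w c b t → Chain≤ w a b (d a c + t)
  Chain-start {c = c} a (done {b = b}) = _ , done , d-tri a c b
  Chain-start {c = c} a (hop {sf = sf} {t = t} e ch) = _ , hop e ch , (begin
    d a sf + t             ≤⟨ +-monoˡ-≤ t (d-tri a c sf) ⟩
    (d a c + d c sf) + t   ≡⟨ +-assoc (d a c) (d c sf) t ⟩
    d a c + (d c sf + t)   ∎)

  Chain-++ : ∀ {u v a c b t₁ t₂} → Chain u a c t₁ → Chain v c b t₂ → Chain≤ (u ++ v) a b (t₁ + t₂)
  Chain-++ {a = a} done ch₂ = Chain-start a ch₂
  Chain-++ {a = a} {t₂ = t₂} (hop {sf = sf} {t = t} e ch₁) ch₂ with Chain-++ ch₁ ch₂
  ... | t′ , ch , t′≤ = _ , hop e ch , (begin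
    d a sf + t′          ≤⟨ +-monoʳ-≤ (d a sf) t′≤ ⟩
    d a sf + (t + t₂)    ≡⟨ +-assoc (d a sf) t t₂ ⟨
    (d a sf + t) + t₂    ∎)

  Chain≤-++ : ∀ {u v a c b t₁ t₂} → Chain≤ u a c t₁ → Chain≤ v c b t₂ → Chain≤ (u ++ v) a b (t₁ + t₂)
  Chain≤-++ (_ , ch₁ , ≤t₁) (_ , ch₂ , ≤t₂) = Chain≤-weaken (Chain-++ ch₁ ch₂) (+-mono-≤ ≤t₁ ≤t₂)

  -- When s and k cancel, the chain jumps from a straight to g: k = s⁻¹ and s is an isometry,
  -- so d(f, k g) = d(s f, g), and the triangle inequality through s f applies.
  push-Chain≤ : ∀ {s u a b t} → Isometry s → Chain (s ∷ u) a b t → Chain≤ (push s u) a b t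
  push-Chain≤ {u = []} _ ch = _ , ch , ≤-refl _
  push-Chain≤ {s} {k ∷ u} _ ch with IsInverse? s k
  ... | no _ = _ , ch , ≤-refl _
  push-Chain≤ {s} {k ∷ u} {a} iso (hop {f = f} {sf} e (hop {f = g} {kg} {t = t} e′ ch)) | yes sk =
    Chain≤-weaken (Chain-start a ch) (begin
      d a g + t                ≤⟨ +-monoˡ-≤ t (d-tri a sf g) ⟩
      (d a sf + d sf g) + t    ≡⟨ cong (λ z → (d a sf + z) + t) (iso f kg sf g e skg) ⟩
      (d a sf + d f kg) + t    ≡⟨ +-assoc (d a sf) (d f kg) t ⟩
      d a sf + (d f kg + t)    ∎)
    where skg = proj₁ (IsInverse-sym {p = s} {k} sk g kg) e′

  Chain-nf : ∀ {w a b t} → All Isometry w → Chain w a b t → Chain≤ (nf w) a b t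
  Chain-nf []           done = _ , done , ≤-refl _
  Chain-nf {a = a} (iso ∷ isos) (hop {sf = sf} e ch) with Chain-nf isos ch
  ... | _ , ch′ , ≤t = Chain≤-weaken (push-Chain≤ iso (hop e ch′)) (+-monoʳ-≤ (d a sf) ≤t)

  Chain≤-nf : ∀ {w a b t} → All Isometry w → Chain≤ w a b t → Chain≤ (nf w) a b t
  Chain≤-nf isos (_ , ch , ≤t) = Chain≤-weaken (Chain-nf isos ch) ≤t

  -- Chains are taken of the reduced word so that Norm≤ only depends on the element of 𝔽(P):
  -- inserting s s⁻¹ can destroy every chain of a word.
  record Norm≤ (w : List (PMap n)) (a b : Fin n) (t : Carrier) : Set where
    constructor norm≤
    field
      nf-isometries : All Isometry (nf w)
      nf-chain      : Chain≤ (nf w) a b t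

  Norm≤-resp-~ : ∀ {u v a b t} → u ~ v → Norm≤ u a b t → Norm≤ v a b t
  Norm≤-resp-~ (mk~ nfu≡nfv) (norm≤ isos ch) =
    norm≤ (subst (All Isometry) nfu≡nfv isos) (subst (λ w → Chain≤ w _ _ _) nfu≡nfv ch)

  Chain≤⇒Norm≤ : ∀ {w a b t} → All Isometry w → Chain≤ w a b t → Norm≤ w a b t
  Chain≤⇒Norm≤ isos ch = norm≤ (nf-All isos) (Chain≤-nf isos ch)

  Norm≤-++ : ∀ {u v a c b t₁ t₂} → Norm≤ u a c t₁ → Norm≤ v c b t₂ → Norm≤ (u ++ v) a b (t₁ + t₂)
  Norm≤-++ {u} {v} (norm≤ isos₁ ch₁) (norm≤ isos₂ ch₂) =
    Norm≤-resp-~ nf-split (Chain≤⇒Norm≤ (++⁺ isos₁ isos₂) (Chain≤-++ ch₁ ch₂))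
    where
    nf-split : nf u ++ nf v ~ u ++ v
    nf-split = ~-trans (~-congˡ (nf v) (nf-~ u)) (~-congʳ u (nf-~ v))

  Norm≤-[]⁺ : ∀ {a b t} → d a b ≤ t → Norm≤ [] a b t
  Norm≤-[]⁺ dab≤t = norm≤ [] (_ , done , dab≤t)

  Norm≤-[]⁻ : ∀ {a b t} → Norm≤ [] a b t → d a b ≤ t
  Norm≤-[]⁻ (norm≤ _ (_ , done , dab≤t)) = dab≤t

module CosetGraph (V : OrderedAbelianGroup) {n : ℕ}
  (d : Fin n → Fin n → OrderedAbelianGroup.Carrier V) (metric : IsMetric V d)
  (a₀ : Fin n) (P : PMap n → Set)
  (P-isometry : ∀ p → P p → IsPartialIsometry V d p)
  (P-inverse : ∀ p → P p → ∃[ q ] (P q × IsInverse p q)) where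
  open OrderedAbelianGroup V
  open OrderedAbelianGroupProperties V
  open IsMetric metric
  open FreeReduction (IsInverse {n}) IsInverse? (λ {p} {q} {r} → IsInverse-unique {p = p} {q} {r})
  open Chains V d metric
  open Graph a₀ P
  open Weighted V d

  isometries : ∀ {w} → All P w → All Isometry w
  isometries = All.map (P-isometry _)

  inv : ∀ {s} → P s → PMap n
  inv s∈P = proj₁ (P-inverse _ s∈P)

  inv∈P : ∀ {s} (s∈P : P s) → P (inv s∈P)
  inv∈P s∈P = proj₁ (proj₂ (P-inverse _ s∈P))

  inv-IsInverse : ∀ {s} (s∈P : P s) → IsInverse s (inv s∈P)
  inv-IsInverse s∈P = proj₂ (proj₂ (P-inverse _ s∈P))

  eval-++-just : ∀ u {v a c} → eval v a ≡ just c → eval (u ++ v) a ≡ eval u c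
  eval-++-just []      e = e
  eval-++-just (s ∷ u) e = cong (_>>= app s) (eval-++-just u e)

  eval-Chain≤ : ∀ w {a b} → eval w b ≡ just a → Chain≤ w a b 0#
  eval-Chain≤ [] {a} refl = _ , done , ≡⇒≤ (d-refl a)
  eval-Chain≤ (s ∷ w) {a} {b} e with eval w b in eq
  ... | just c with eval-Chain≤ w eq
  ...   | t , ch , t≤0 = _ , hop e ch , (begin
    d a a + t    ≡⟨ cong (_+ t) (d-refl a) ⟩
    0# + t       ≡⟨ +-identityˡ t ⟩
    t            ≤⟨ t≤0 ⟩
    0#           ∎)
    where open ≤-Reasoning

  Norm≤-eval : ∀ {w a b} → All P w → eval w b ≡ just a → Norm≤ w a b 0#
  Norm≤-eval {w} w∈P* e = Chain≤⇒Norm≤ (isometries w∈P*) (eval-Chain≤ w e)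

  Norm≤-prepend : ∀ {u w a a′ b t} → All P u → eval u a ≡ just a′ → Norm≤ w a b t → Norm≤ (u ++ w) a′ b t
  Norm≤-prepend {t = t} u∈P* e w≤t =
    subst (Norm≤ _ _ _) (+-identityˡ t) (Norm≤-++ (Norm≤-eval u∈P* e) w≤t)

  Norm≤-append : ∀ {w u a b b′ t} → All P u → eval u b′ ≡ just b → Norm≤ w a b t → Norm≤ (w ++ u) a b′ t
  Norm≤-append {t = t} u∈P* e w≤t =
    subst (Norm≤ _ _ _) (+-identityʳ t) (Norm≤-++ w≤t (Norm≤-eval u∈P* e))

  ≈F⇒~ : ∀ {u v} → u ≈F v → u ~ v
  ≈F⇒~ (cancel u v _ _ _ _ pq) = ~-cancel u v pq
  ≈F⇒~ ≈-refl                  = ~-refl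
  ≈F⇒~ (≈-sym u≈v)             = ~-sym (≈F⇒~ u≈v)
  ≈F⇒~ (≈-trans u≈v v≈w)       = ~-trans (≈F⇒~ u≈v) (≈F⇒~ v≈w)

  inverse : (u : Word) → All P u → Word
  inverse []      []          = []
  inverse (s ∷ u) (s∈P ∷ u∈P*) = inverse u u∈P* ++ [ inv s∈P ]

  inverse-All : ∀ u u∈P* → All P (inverse u u∈P*)
  inverse-All []      []           = []
  inverse-All (s ∷ u) (s∈P ∷ u∈P*) = ++⁺ (inverse-All u u∈P*) (inv∈P s∈P ∷ [])

  inverse-cancelˡ : ∀ u u∈P* → inverse u u∈P* ++ u ~ []
  inverse-cancelˡ []      []           = ~-refl
  inverse-cancelˡ (s ∷ u) (s∈P ∷ u∈P*) = begin
    (u⁻¹ ++ [ inv s∈P ]) ++ s ∷ u   ≡⟨ ++-assoc u⁻¹ [ inv s∈P ] (s ∷ u) ⟩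
    u⁻¹ ++ inv s∈P ∷ s ∷ u          ≈⟨ ~-cancel u⁻¹ u (IsInverse-sym {p = s} {inv s∈P} (inv-IsInverse s∈P)) ⟩
    u⁻¹ ++ u                        ≈⟨ inverse-cancelˡ u u∈P* ⟩
    []                              ∎
    where
    open ~-Reasoning
    u⁻¹ = inverse u u∈P*

  inverse-cancelʳ : ∀ u u∈P* → u ++ inverse u u∈P* ~ []
  inverse-cancelʳ []      []           = ~-refl
  inverse-cancelʳ (s ∷ u) (s∈P ∷ u∈P*) = begin
    s ∷ u ++ u⁻¹ ++ [ inv s∈P ]         ≡⟨ cong (s ∷_) (++-assoc u u⁻¹ [ inv s∈P ]) ⟨
    [ s ] ++ (u ++ u⁻¹) ++ [ inv s∈P ]  ≈⟨ ~-erase [ s ] [ inv s∈P ] (inverse-cancelʳ u u∈P*) ⟩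
    [] ++ s ∷ inv s∈P ∷ []              ≈⟨ ~-cancel [] [] (inv-IsInverse s∈P) ⟩
    []                                  ∎
    where
    open ~-Reasoning
    u⁻¹ = inverse u u∈P*

  eval-inverse : ∀ u u∈P* {a b} → eval u b ≡ just a → eval (inverse u u∈P*) a ≡ just b
  eval-inverse []      []           refl = refl
  eval-inverse (s ∷ u) (s∈P ∷ u∈P*) {a} {b} e with eval u b in eq
  ... | just c = trans (eval-++-just (inverse u u∈P*) (proj₁ (inv-IsInverse s∈P c a) e))
                       (eval-inverse u u∈P* eq)

  coset-representative : ∀ {x y} → SameCoset x y → ∃[ w ] (All P w × eval w a₀ ≡ just a₀ × y ~ x ++ w)
  coset-representative {x} (_ , (_ , w , w∈P* , w≈h , wa₀) , y≈xh) =
    w , w∈P* , wa₀ , ~-trans (≈F⇒~ y≈xh) (~-congʳ x (~-sym (≈F⇒~ w≈h)))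

  SameCoset-refl : ∀ x → SameCoset x x
  SameCoset-refl x = [] , ([] , [] , [] , ≈-refl , refl) , subst (x ≈F_) (sym (++-identityʳ x)) ≈-refl

  letter : Maybe (PMap n) → Word
  letter nothing  = []
  letter (just p) = [ p ]

  letter-All : ∀ {p} → InP1 p → All P (letter p)
  letter-All {nothing} _   = []
  letter-All {just _}  p∈P = p∈P ∷ []

  eval-letter : ∀ p → eval (letter p) a₀ ≡ at₀ p
  eval-letter nothing  = refl
  eval-letter (just _) = refl

  ext-letter : ∀ g p → ext g p ≡ g ++ letter p
  ext-letter g nothing  = sym (++-identityʳ g)
  ext-letter g (just _) = refl

  vertex-form : ∀ g p {x a} → InP1 p → at₀ p ≡ just a → SameCoset (ext g p) x →
                ∃[ U ] (All P U × eval U a₀ ≡ just a × x ~ g ++ U)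
  vertex-form g p {x} p∈P₁ pa₀≡a gpH≡xH with coset-representative gpH≡xH
  ... | w , w∈P* , wa₀ , x~gpw =
    letter p ++ w ,
    ++⁺ (letter-All p∈P₁) w∈P* ,
    trans (eval-++-just (letter p) wa₀) (trans (eval-letter p) pa₀≡a) ,
    ~-trans x~gpw (≡⇒~ (trans (cong (_++ w) (ext-letter g p)) (++-assoc g (letter p) w)))

  translate-difference : ∀ {x z} g {U W} (x∈P* : All P x) (U∈P* : All P U) → x ~ g ++ U → z ~ g ++ W →
                         inverse x x∈P* ++ z ~ inverse U U∈P* ++ W
  translate-difference {x} {z} g {U} {W} x∈P* U∈P* x~gU z~gW = begin
    x⁻¹ ++ z                        ≈⟨ ~-congʳ x⁻¹ z~gW ⟩
    x⁻¹ ++ g ++ W                   ≈⟨ ~-congʳ x⁻¹ (~-erase g W (inverse-cancelʳ U U∈P*)) ⟨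
    x⁻¹ ++ g ++ (U ++ U⁻¹) ++ W     ≡⟨ cong (λ v → x⁻¹ ++ g ++ v) (++-assoc U U⁻¹ W) ⟩
    x⁻¹ ++ g ++ U ++ U⁻¹ ++ W       ≡⟨ cong (x⁻¹ ++_) (++-assoc g U (U⁻¹ ++ W)) ⟨
    x⁻¹ ++ (g ++ U) ++ U⁻¹ ++ W     ≡⟨ ++-assoc x⁻¹ (g ++ U) (U⁻¹ ++ W) ⟨
    (x⁻¹ ++ (g ++ U)) ++ U⁻¹ ++ W   ≈⟨ ~-congˡ (U⁻¹ ++ W) (~-congʳ x⁻¹ x~gU) ⟨
    (x⁻¹ ++ x) ++ U⁻¹ ++ W          ≈⟨ ~-congˡ (U⁻¹ ++ W) (inverse-cancelˡ x x∈P*) ⟩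
    U⁻¹ ++ W                        ∎
    where
    open ~-Reasoning
    x⁻¹ = inverse x x∈P*
    U⁻¹ = inverse U U∈P*

  record EdgeForm (x : Word) (x∈P* : All P x) (z : Word) (r : Carrier) : Set where
    constructor edge-form
    field
      U W        : Word
      a b        : Fin n
      U∈P*       : All P U
      W∈P*       : All P W
      Ua₀≡a      : eval U a₀ ≡ just a
      Wa₀≡b      : eval W a₀ ≡ just b
      difference : inverse x x∈P* ++ z ~ inverse U U∈P* ++ W
      weight     : r ≡ d a b

  Edge⇒EdgeForm : ∀ {x z r} → Edge x z r → (x∈P* : All P x) → EdgeForm x x∈P* z r
  Edge⇒EdgeForm (_ , _ , _ , g , p , q , a , b , _ , p∈P₁ , q∈P₁ , pa₀≡a , qa₀≡b , gpH≡xH , gqH≡zH , r≡dab) x∈P*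
    with vertex-form g p p∈P₁ pa₀≡a gpH≡xH | vertex-form g q q∈P₁ qa₀≡b gqH≡zH
  ... | U , U∈P* , Ua₀≡a , x~gU | W , W∈P* , Wa₀≡b , z~gW =
    edge-form U W a b U∈P* W∈P* Ua₀≡a Wa₀≡b (translate-difference g x∈P* U∈P* x~gU z~gW) r≡dab

  Edge⇒Norm≤ : ∀ {x z r} → Edge x z r → (x∈P* : All P x) → Norm≤ (inverse x x∈P* ++ z) a₀ a₀ r
  Edge⇒Norm≤ e x∈P* with Edge⇒EdgeForm e x∈P*
  ... | edge-form U W a b U∈P* W∈P* Ua₀≡a Wa₀≡b x⁻¹z~U⁻¹W refl =
    Norm≤-resp-~ (~-sym x⁻¹z~U⁻¹W)
      (Norm≤-prepend (inverse-All U U∈P*) (eval-inverse U U∈P* Ua₀≡a)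
        (Norm≤-append W∈P* Wa₀≡b (Norm≤-[]⁺ (≤-refl (d a b)))))

  Edge-Norm≤-least : ∀ {x z r s} → Edge x z r → (x∈P* : All P x) → Norm≤ (inverse x x∈P* ++ z) a₀ a₀ s → r ≤ s
  Edge-Norm≤-least e x∈P* x⁻¹z≤s with Edge⇒EdgeForm e x∈P*
  ... | edge-form U W a b U∈P* W∈P* Ua₀≡a Wa₀≡b x⁻¹z~U⁻¹W refl =
    Norm≤-[]⁻ (Norm≤-resp-~ conjugate-trivial
      (Norm≤-prepend U∈P* Ua₀≡a
        (Norm≤-append (inverse-All W W∈P*) (eval-inverse W W∈P* Wa₀≡b)
          (Norm≤-resp-~ x⁻¹z~U⁻¹W x⁻¹z≤s))))
    where
    open ~-Reasoning
    U⁻¹ = inverse U U∈P*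
    W⁻¹ = inverse W W∈P*
    conjugate-trivial : U ++ (U⁻¹ ++ W) ++ W⁻¹ ~ []
    conjugate-trivial = begin
      U ++ (U⁻¹ ++ W) ++ W⁻¹     ≡⟨ cong (U ++_) (++-assoc U⁻¹ W W⁻¹) ⟩
      U ++ U⁻¹ ++ W ++ W⁻¹       ≡⟨ ++-assoc U U⁻¹ (W ++ W⁻¹) ⟨
      (U ++ U⁻¹) ++ W ++ W⁻¹     ≈⟨ ~-congˡ (W ++ W⁻¹) (inverse-cancelʳ U U∈P*) ⟩
      W ++ W⁻¹                   ≈⟨ inverse-cancelʳ W W∈P* ⟩
      []                         ∎

  Path⇒Norm≤ : ∀ {x y s} → Path x y s → (x∈P* : All P x) → Norm≤ (inverse x x∈P* ++ y) a₀ a₀ s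
  Path⇒Norm≤ {x} {y} (nil xH≡yH) x∈P* with coset-representative xH≡yH
  ... | w , w∈P* , wa₀ , y~xw = Norm≤-resp-~ w~x⁻¹y (Norm≤-eval w∈P* wa₀)
    where
    open ~-Reasoning
    x⁻¹ = inverse x x∈P*
    w~x⁻¹y : w ~ x⁻¹ ++ y
    w~x⁻¹y = begin
      w                 ≈⟨ ~-congˡ w (inverse-cancelˡ x x∈P*) ⟨
      (x⁻¹ ++ x) ++ w   ≡⟨ ++-assoc x⁻¹ x w ⟩
      x⁻¹ ++ x ++ w     ≈⟨ ~-congʳ x⁻¹ y~xw ⟨
      x⁻¹ ++ y          ∎
  Path⇒Norm≤ {x} {y} (cons {z = z} e path) x∈P* =
    Norm≤-resp-~ split (Norm≤-++ (Edge⇒Norm≤ e x∈P*) (Path⇒Norm≤ path z∈P*))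
    where
    open ~-Reasoning
    z∈P* = proj₁ (proj₂ e)
    x⁻¹ = inverse x x∈P*
    z⁻¹ = inverse z z∈P*
    split : (x⁻¹ ++ z) ++ z⁻¹ ++ y ~ x⁻¹ ++ y
    split = begin
      (x⁻¹ ++ z) ++ z⁻¹ ++ y   ≡⟨ ++-assoc x⁻¹ z (z⁻¹ ++ y) ⟩
      x⁻¹ ++ z ++ z⁻¹ ++ y     ≡⟨ cong (x⁻¹ ++_) (++-assoc z z⁻¹ y) ⟨
      x⁻¹ ++ (z ++ z⁻¹) ++ y   ≈⟨ ~-erase x⁻¹ y (inverse-cancelʳ z z∈P*) ⟩
      x⁻¹ ++ y                 ∎

  Edge⇒Path : ∀ {x y r} → Edge x y r → Path x y (r + 0#)
  Edge⇒Path {y = y} e = cons e (nil (SameCoset-refl y))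

lemma3p2 : (V : OrderedAbelianGroup) (n : ℕ)
    (d : Fin n → Fin n → OrderedAbelianGroup.Carrier V) → IsMetric V d →
    (a₀ : Fin n) (P : PMap n → Set) →
    (∀ p → P p → IsPartialIsometry V d p × NotInIdentity p) →
    (∀ p → P p → ∃[ q ] (P q × IsInverse p q)) →
    (∀ b → b ≢ a₀ → ∃[ p ] (P p × app p a₀ ≡ just b)) →
    ∀ x y r → Graph.Weighted.Edge a₀ P V d x y r →
    ∀ B → IsSup V (Graph.Weighted.EdgeWeight a₀ P V d) B →
    ∀ δ → IsInf V (Graph.Weighted.Path a₀ P V d x y) δ →
    ∀ m → IsMin V B δ m → m ≡ r
lemma3p2 V n d metric a₀ P P-properties P-inverse _ x y r e B B-sup δ δ-inf m m-min =
  IsMin-≤ r≤B (subst (λ δ′ → IsMin V B δ′ m) δ≡r m-min)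
  where
  open OrderedAbelianGroup V
  open OrderedAbelianGroupProperties V
  open CosetGraph V d metric a₀ P (λ p p∈P → proj₁ (P-properties p p∈P)) P-inverse
  x∈P* : All P x
  x∈P* = proj₁ e
  r≤B : r ≤ B
  r≤B = proj₁ B-sup r (x , y , e)
  δ≤r : δ ≤ r
  δ≤r = subst (δ ≤_) (+-identityʳ r) (proj₁ δ-inf (r + 0#) (Edge⇒Path e))
  r≤δ : r ≤ δ
  r≤δ = proj₂ δ-inf r λ s path → Edge-Norm≤-least e x∈P* (Path⇒Norm≤ path x∈P*)
  δ≡r : δ ≡ r
  δ≡r = ≤-antisym δ≤r r≤δ
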